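{- Let $\mathrm{ftm}(n)$ be $0$ if the Fibonacci (Zeckendorf) representation of $n$ has an even number of $1$'s and $1$ if it has an odd number of $1$'s. Then the running sum $\mathrm{sum}_{\mathrm{ftm}}(n)=\sum_{i=0}^{n}\mathrm{ftm}(i)$ is not Fibonacci-synchronised.
   Context: Fibonacci numbers: $F_0=0$, $F_1=1$, $F_n=F_{n-1}+F_{n-2}$. The Fibonacci (Zeckendorf) representation of $n$ is the unique binary word $a_k\cdots a_0$ with no two consecutive $1$'s (and no leading zeros) such that $n=\sum_{i} a_i F_{i+2}$. A function $f:\mathbb{N}\to\mathbb{N}$ is Fibonacci-synchronised if there is a finite automaton which, reading the Fibonacci representations of $n$ and $m$ in parallel (most significant digit first, the shorter padded with leading zeros), accepts exactly the pairs $(n,m)$ with $m=f(n)$. -}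

module Defs where

open import Data.Nat using (ℕ; zero; suc; _+_; _∸_; _⊔_)
open import Data.Bool using (Bool; true; false; T)
open import Data.List using (List; []; _∷_; length; replicate; _++_; zip)
open import Data.Fin using (Fin)
open import Data.Product using (_×_; Σ; ∃)
open import Data.Empty using (⊥)
open import Data.Unit using (⊤)
open import Relation.Binary.PropositionalEquality using (_≡_)
open import Function.Bundles using (_⇔_)

fib : ℕ → ℕ
fib zero = zero
fib (suc zero) = suc zero
fib (suc (suc n)) = fib (suc n) + fib n

-- Value of a binary word a_k ⋯ a_0 (most significant digit first):
-- Σ a_i F_{i+2}.
fibValue : List Bool → ℕ
fibValue [] = 0
fibValue (true  ∷ w) = fib (length w + 2) + fibValue w
fibValue (false ∷ w) = fibValue w

NoConsecOnes : List Bool → Set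
NoConsecOnes [] = ⊤
NoConsecOnes (true ∷ true ∷ w) = ⊥
NoConsecOnes (_ ∷ w) = NoConsecOnes w

NoLeadingZero : List Bool → Set
NoLeadingZero [] = ⊤
NoLeadingZero (b ∷ _) = T b

IsZeck : List Bool → ℕ → Set
IsZeck w n = NoLeadingZero w × NoConsecOnes w × fibValue w ≡ n

ZeckRep : (ℕ → List Bool) → Set
ZeckRep rep = ∀ n → IsZeck (rep n) n

ones : List Bool → ℕ
ones [] = 0
ones (true ∷ w) = suc (ones w)
ones (false ∷ w) = ones w

parity : ℕ → ℕ
parity zero = 0
parity (suc zero) = 1
parity (suc (suc n)) = parity n

ftm : (ℕ → List Bool) → ℕ → ℕ
ftm rep n = parity (ones (rep n))

sumFtm : (ℕ → List Bool) → ℕ → ℕ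
sumFtm rep zero = ftm rep zero
sumFtm rep (suc n) = sumFtm rep n + ftm rep (suc n)

padPair : List Bool → List Bool → List (Bool × Bool)
padPair u v =
  zip (replicate (L ∸ length u) false ++ u) (replicate (L ∸ length v) false ++ v)
  where L = length u ⊔ length v

record DFA : Set where
  field
    size   : ℕ
    start  : Fin size
    step   : Fin size → Bool × Bool → Fin size
    accept : Fin size → Bool

run : (A : DFA) → Fin (DFA.size A) → List (Bool × Bool) → Fin (DFA.size A)
run A q [] = q
run A q (c ∷ w) = run A (DFA.step A q c) w

Accepts : DFA → List (Bool × Bool) → Set
Accepts A w = T (DFA.accept A (run A (DFA.start A) w))

FibSynchronised : (ℕ → List Bool) → (ℕ → ℕ) → Set
FibSynchronised rep f =
  Σ DFA λ A → ∀ n m → (Accepts A (padPair (rep n) (rep m)) ⇔ (m ≡ f n))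

{-# OPTIONS --safe #-}
-- Let S x = Σ_{i<x} ftm i and D x = 2 S x − x. For i < F_{k+1} the Zeckendorf word of F_{k+2} + i
-- is 1 0⋯0 rep(i), so ftm (F_{k+2} + i) = 1 − ftm i and D (F_{k+2} + i) = D F_{k+2} − D i. Hence
-- D F_{k+3} = − D F_k for k ≥ 1, and for the value N_M of (100100)^M one finds
-- N_M = 2 sumFtm N_M + 2M.
--
-- If an automaton with s states synchronised sumFtm, it would accept (100100)^K paired with the
-- padded representation of sumFtm N_K. For K > 2s two block boundaries agree in the state and in
-- the last bit of the second component, so the blocks in between can be pumped while both
-- components stay Zeckendorf words; along the pumped family, the value of the first component minus
-- twice that of the second then grows linearly in the number r of pumps. But the values of x yʳ z
-- satisfy a linear recurrence with characteristic polynomial (X − 1)(X² − t X + (−1)^ℓ), where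
-- ℓ = |y| and t = F_{ℓ+1} + F_{ℓ−1}. Here ℓ is a multiple of the block length 6, so (−1)^ℓ = 1,
-- and on an arithmetic progression of slope δ the operator yields δ (2 − t), nonzero as t ≥ 3.

module Submission where

open import Defs
open import Data.Nat using (ℕ)
open import Data.Bool using (Bool)
open import Data.List using (List)
open import Relation.Nullary using (¬_)

open import Data.Nat using (zero; suc; _≤_; _<_; z≤n; s≤s)
open import Data.Bool using (true; false; T)
open import Data.List using ([]; _∷_; _++_; length; replicate; zip; take)
open import Data.List.Properties using (++-assoc; ++-identityʳ; length-++; length-replicate)
open import Data.Product using (_×_; _,_; proj₁; proj₂; Σ; ∃; ∃₂)
open import Data.Sum using ([_,_]′)
open import Function using (_∘_)
open import Data.Empty using (⊥-elim)
open import Data.Unit using (tt)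
open import Relation.Binary.PropositionalEquality
open import Data.Nat.Properties using (<⇒≢)

module Fibonacci where
  open import Data.Nat using (_+_; _*_)
  open import Data.Nat.Properties
  open import Data.Nat.Tactic.RingSolver using (solve-∀)

  fib-suc-pos : ∀ n → 0 < fib (suc n)
  fib-suc-pos zero = s≤s z≤n
  fib-suc-pos (suc n) = ≤-trans (fib-suc-pos n) (m≤m+n _ _)

  fib-mono-≤ : ∀ {m n} → m ≤ n → fib m ≤ fib n
  fib-mono-≤ z≤n = z≤n
  fib-mono-≤ (s≤s {n = n} z≤n) = fib-suc-pos n
  fib-mono-≤ (s≤s (s≤s m≤n)) = +-mono-≤ (fib-mono-≤ (s≤s m≤n)) (fib-mono-≤ m≤n)

  fib-cancel-< : ∀ {m n} → fib m < fib n → m < n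
  fib-cancel-< fm<fn = ≰⇒> (λ n≤m → <⇒≱ fm<fn (fib-mono-≤ n≤m))

  fib-+ : ∀ m n → fib (suc (m + n)) ≡ fib (suc m) * fib (suc n) + fib m * fib n
  fib-+ zero n = sym (trans (+-identityʳ _) (+-identityʳ _))
  fib-+ (suc zero) n = sym (cong₂ _+_ (+-identityʳ (fib (suc n))) (+-identityʳ (fib n)))
  fib-+ (suc (suc m)) n = begin
    fib (suc (suc m) + n) + fib (suc m + n)
      ≡⟨ cong₂ _+_ (fib-+ (suc m) n) (fib-+ m n) ⟩
    (fib (suc (suc m)) * fib (suc n) + fib (suc m) * fib n) + (fib (suc m) * fib (suc n) + fib m * fib n)
      ≡⟨ regroup (fib (suc (suc m))) (fib (suc m)) (fib m) (fib (suc n)) (fib n) ⟩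
    (fib (suc (suc m)) + fib (suc m)) * fib (suc n) + (fib (suc m) + fib m) * fib n ∎
    where
    open ≡-Reasoning
    regroup : ∀ a b c x y → (a * x + b * y) + (b * x + c * y) ≡ (a + b) * x + (b + c) * y
    regroup = solve-∀

open Fibonacci

module Words where
  open import Data.Nat using (_+_; _*_)
  open import Data.Nat.Properties

  private variable
    A B : Set

  infixr 8 _^_
  _^_ : List A → ℕ → List A
  w ^ zero = []
  w ^ suc r = w ++ w ^ r

  ^-+ : ∀ (w : List A) m n → w ^ (m + n) ≡ w ^ m ++ w ^ n
  ^-+ w zero n = refl
  ^-+ w (suc m) n = trans (cong (w ++_) (^-+ w m n)) (sym (++-assoc w (w ^ m) (w ^ n)))

  ^-* : ∀ (w : List A) m n → w ^ (m * n) ≡ (w ^ n) ^ m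
  ^-* w zero n = refl
  ^-* w (suc m) n = trans (^-+ w n (m * n)) (cong (w ^ n ++_) (^-* w m n))

  ^-suc : ∀ (w : List A) r → w ^ suc r ≡ w ^ r ++ w
  ^-suc w zero = ++-identityʳ w
  ^-suc w (suc r) = trans (cong (w ++_) (^-suc w r)) (sym (++-assoc w (w ^ r) w))

  ^-pumped : ∀ (w : List A) i r ℓ k → w ^ (i + r * ℓ + k) ≡ w ^ i ++ (w ^ ℓ) ^ r ++ w ^ k
  ^-pumped w i r ℓ k = begin
    w ^ (i + r * ℓ + k)              ≡⟨ ^-+ w (i + r * ℓ) k ⟩
    w ^ (i + r * ℓ) ++ w ^ k         ≡⟨ cong (_++ w ^ k) (^-+ w i (r * ℓ)) ⟩
    (w ^ i ++ w ^ (r * ℓ)) ++ w ^ k  ≡⟨ ++-assoc (w ^ i) _ _ ⟩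
    w ^ i ++ w ^ (r * ℓ) ++ w ^ k    ≡⟨ cong (λ u → w ^ i ++ u ++ w ^ k) (^-* w r ℓ) ⟩
    w ^ i ++ (w ^ ℓ) ^ r ++ w ^ k    ∎
    where open ≡-Reasoning

  length-^ : ∀ (w : List A) r → length (w ^ r) ≡ r * length w
  length-^ w zero = refl
  length-^ w (suc r) = trans (length-++ w) (cong (length w +_) (length-^ w r))

  zip-++ : ∀ (a b : List A) (u w : List B) → length a ≡ length u →
           zip (a ++ b) (u ++ w) ≡ zip a u ++ zip b w
  zip-++ [] b [] w _ = refl
  zip-++ (c ∷ a) b (d ∷ u) w |a|≡|u| = cong ((c , d) ∷_) (zip-++ a b u w (suc-injective |a|≡|u|))

  zip-^ : ∀ (a : List A) (u : List B) → length a ≡ length u → ∀ r → zip (a ^ r) (u ^ r) ≡ zip a u ^ r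
  zip-^ a u |a|≡|u| zero = refl
  zip-^ a u |a|≡|u| (suc r) =
    trans (zip-++ a (a ^ r) u (u ^ r) |a|≡|u|) (cong (zip a u ++_) (zip-^ a u |a|≡|u| r))

  take-length-++ : ∀ (u w : List A) → take (length u) (u ++ w) ≡ u
  take-length-++ [] w = refl
  take-length-++ (c ∷ u) w = cong (c ∷_) (take-length-++ u w)

  split-length : ∀ m n (v : List A) → length v ≡ m + n →
                 ∃₂ λ x w → v ≡ x ++ w × length x ≡ m × length w ≡ n
  split-length zero n v |v| = [] , v , refl , refl , |v|
  split-length (suc m) n (c ∷ v) |v| with split-length m n v (suc-injective |v|)
  ... | x , w , v≡x++w , |x| , |w| = c ∷ x , w , cong (c ∷_) v≡x++w , cong suc |x| , |w|

  lastBit : Bool → List Bool → Bool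
  lastBit c [] = c
  lastBit _ (c ∷ w) = lastBit c w

  lastBit-++ : ∀ c u w → lastBit c (u ++ w) ≡ lastBit (lastBit c u) w
  lastBit-++ c [] w = refl
  lastBit-++ _ (c ∷ u) w = lastBit-++ c u w

  lastBit-^ : ∀ c y → lastBit c y ≡ c → ∀ r → lastBit c (y ^ r) ≡ c
  lastBit-^ c y e zero = refl
  lastBit-^ c y e (suc r) =
    trans (lastBit-++ c y (y ^ r)) (trans (cong (λ c′ → lastBit c′ (y ^ r)) e) (lastBit-^ c y e r))

  no11-∷⁻ : ∀ c w → NoConsecOnes (c ∷ w) → NoConsecOnes w
  no11-∷⁻ false w h = h
  no11-∷⁻ true [] h = tt
  no11-∷⁻ true (false ∷ w) h = h

  no11-++⁻ : ∀ c u w → NoConsecOnes (c ∷ u ++ w) →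
             NoConsecOnes (c ∷ u) × NoConsecOnes (lastBit c u ∷ w)
  no11-++⁻ false [] w h = tt , h
  no11-++⁻ true [] w h = tt , h
  no11-++⁻ false (c ∷ u) w h = no11-++⁻ c u w h
  no11-++⁻ true (false ∷ u) w h = no11-++⁻ false u w h

  no11-++⁺ : ∀ c u w → NoConsecOnes (c ∷ u) → NoConsecOnes (lastBit c u ∷ w) →
             NoConsecOnes (c ∷ u ++ w)
  no11-++⁺ c [] w _ h = h
  no11-++⁺ false (c ∷ u) w h₁ h₂ = no11-++⁺ c u w h₁ h₂
  no11-++⁺ true (false ∷ u) w h₁ h₂ = no11-++⁺ false u w h₁ h₂

  no11-^ : ∀ c y → NoConsecOnes (c ∷ y) → lastBit c y ≡ c → ∀ r → NoConsecOnes (c ∷ y ^ r)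
  no11-^ false y h e zero = tt
  no11-^ true y h e zero = tt
  no11-^ c y h e (suc r) =
    no11-++⁺ c y (y ^ r) h (subst (λ c′ → NoConsecOnes (c′ ∷ y ^ r)) (sym e) (no11-^ c y h e r))

  no11-pump : ∀ x y z → lastBit false (x ++ y) ≡ lastBit false x → NoConsecOnes (x ++ y ++ z) →
              ∀ r → NoConsecOnes (x ++ y ^ r ++ z)
  no11-pump x y z loop h r =
    no11-++⁺ false x (y ^ r ++ z) no11-x
      (no11-++⁺ c (y ^ r) z (no11-^ c y no11-y y-loop r)
        (subst (λ c′ → NoConsecOnes (c′ ∷ z)) (sym (lastBit-^ c y y-loop r)) no11-z))
    where
    c = lastBit false x
    y-loop : lastBit c y ≡ c
    y-loop = trans (sym (lastBit-++ false x y)) loop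
    split-x = no11-++⁻ false x (y ++ z) h
    split-y = no11-++⁻ c y z (proj₂ split-x)
    no11-x = proj₁ split-x
    no11-y = proj₁ split-y
    no11-z = subst (λ c′ → NoConsecOnes (c′ ∷ z)) y-loop (proj₂ split-y)

open Words

module Zeckendorf where
  open import Data.Nat using (_+_; _*_)
  open import Data.Nat.Properties
  open import Data.Nat.Tactic.RingSolver using (solve-∀)

  fibValue-true : ∀ w → fibValue (true ∷ w) ≡ fib (suc (suc (length w))) + fibValue w
  fibValue-true w = cong (λ i → fib i + fibValue w) (+-comm (length w) 2)

  fibValue-< : ∀ w → NoConsecOnes w → fibValue w < fib (suc (suc (length w)))
  fibValue-< [] _ = s≤s z≤n
  fibValue-< (false ∷ w) h = <-≤-trans (fibValue-< w h) (fib-mono-≤ (n≤1+n (suc (suc (length w)))))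
  fibValue-< (true ∷ []) _ = s≤s (s≤s z≤n)
  fibValue-< (true ∷ false ∷ w) h = begin-strict
    fibValue (true ∷ false ∷ w)                     ≡⟨ fibValue-true (false ∷ w) ⟩
    fib (suc (suc (suc (length w)))) + fibValue w   <⟨ +-monoʳ-< _ (fibValue-< w h) ⟩
    fib (suc (suc (suc (length w)))) + fib (suc (suc (length w))) ∎
    where open ≤-Reasoning

  fib≤fibValue-true : ∀ w → fib (suc (suc (length w))) ≤ fibValue (true ∷ w)
  fib≤fibValue-true w = ≤-trans (m≤m+n _ _) (≤-reflexive (sym (fibValue-true w)))

  private
    true-false-absurd : ∀ u v → length u ≡ length v → NoConsecOnes v →
                        fibValue (true ∷ u) ≢ fibValue (false ∷ v)
    true-false-absurd u v |u|≡|v| h e = <⇒≱ (fibValue-< v h)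
      (subst (λ n → fib (suc (suc n)) ≤ fibValue v) |u|≡|v| (subst (_ ≤_) e (fib≤fibValue-true u)))

  no11-injective : ∀ u v → length u ≡ length v → NoConsecOnes u → NoConsecOnes v →
                   fibValue u ≡ fibValue v → u ≡ v
  no11-injective [] [] _ _ _ _ = refl
  no11-injective (false ∷ u) (false ∷ v) |u|≡|v| hu hv e =
    cong (false ∷_) (no11-injective u v (suc-injective |u|≡|v|) hu hv e)
  no11-injective (true ∷ u) (true ∷ v) |u|≡|v| hu hv e =
    cong (true ∷_) (no11-injective u v |u|≡|v|′ (no11-∷⁻ true u hu) (no11-∷⁻ true v hv)
      (+-cancelˡ-≡ (fib (length u + 2)) _ _
        (trans e (cong (λ n → fib (n + 2) + fibValue v) (sym |u|≡|v|′)))))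
    where |u|≡|v|′ = suc-injective |u|≡|v|
  no11-injective (true ∷ u) (false ∷ v) |u|≡|v| hu hv e =
    ⊥-elim (true-false-absurd u v (suc-injective |u|≡|v|) hv e)
  no11-injective (false ∷ u) (true ∷ v) |u|≡|v| hu hv e =
    ⊥-elim (true-false-absurd v u (suc-injective (sym |u|≡|v|)) hu (sym e))

  zeck-length-≤ : ∀ {w n} k → IsZeck w n → n < fib (suc (suc k)) → length w ≤ k
  zeck-length-≤ {[]} k _ _ = z≤n
  zeck-length-≤ {true ∷ w} k (_ , _ , refl) n<fib =
    ≤-pred (≤-pred (fib-cancel-< (≤-<-trans (fib≤fibValue-true w) n<fib)))

  zeck-unique : ∀ {u v n} → IsZeck u n → IsZeck v n → u ≡ v
  zeck-unique {u} {v} zu@(_ , hu , refl) zv@(_ , hv , ev) =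
    no11-injective u v |u|≡|v| hu hv (sym ev)
    where
    |u|≡|v| : length u ≡ length v
    |u|≡|v| = ≤-antisym
      (zeck-length-≤ {u} (length v) zu (subst (_< fib (suc (suc (length v)))) ev (fibValue-< v hv)))
      (zeck-length-≤ {v} (length u) zv (fibValue-< u hu))

  fibValue-pad : ∀ z w → fibValue (replicate z false ++ w) ≡ fibValue w
  fibValue-pad zero w = refl
  fibValue-pad (suc z) w = fibValue-pad z w

  ones-pad : ∀ z w → ones (replicate z false ++ w) ≡ ones w
  ones-pad zero w = refl
  ones-pad (suc z) w = ones-pad z w

  no11-pad⁺ : ∀ z w → NoConsecOnes w → NoConsecOnes (replicate z false ++ w)
  no11-pad⁺ zero w h = h
  no11-pad⁺ (suc z) w h = no11-pad⁺ z w h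

  no11-pad⁻ : ∀ z w → NoConsecOnes (replicate z false ++ w) → NoConsecOnes w
  no11-pad⁻ zero w h = h
  no11-pad⁻ (suc z) w h = no11-pad⁻ z w h

  length-pad : ∀ z (w : List Bool) → length (replicate z false ++ w) ≡ z + length w
  length-pad z w = trans (length-++ (replicate z false)) (cong (_+ length w) (length-replicate z))

  strip-zeros : ∀ v → ∃₂ λ z u → v ≡ replicate z false ++ u × NoLeadingZero u
  strip-zeros [] = 0 , [] , refl , tt
  strip-zeros (true ∷ v) = 0 , true ∷ v , refl , tt
  strip-zeros (false ∷ v) with strip-zeros v
  ... | z , u , v≡ , h = suc z , u , cong (false ∷_) v≡ , h

  fibValue₁ : List Bool → ℕ
  fibValue₁ [] = 0
  fibValue₁ (true ∷ w) = fib (suc (length w)) + fibValue₁ w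
  fibValue₁ (false ∷ w) = fibValue₁ w

  private
    absorb : ∀ a b c → c ≡ a * 0 + b * 0 + c
    absorb = solve-∀

    regroup : ∀ a b f g x y c → (a * f + b * g) + (a * x + b * y + c) ≡ a * (f + x) + b * (g + y) + c
    regroup = solve-∀

    length-++-suc : ∀ (u v : List Bool) → suc (length (u ++ v)) ≡ length v + suc (length u)
    length-++-suc u v = trans (cong suc (trans (length-++ u) (+-comm (length u) (length v))))
                              (sym (+-suc (length v) (length u)))

  fibValue-++ : ∀ u v → fibValue (u ++ v) ≡
                fib (suc (length v)) * fibValue u + fib (length v) * fibValue₁ u + fibValue v
  fibValue-++ [] v = absorb (fib (suc (length v))) (fib (length v)) (fibValue v)
  fibValue-++ (false ∷ u) v = fibValue-++ u v
  fibValue-++ (true ∷ u) v = begin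
    fibValue (true ∷ u ++ v)
      ≡⟨ fibValue-true (u ++ v) ⟩
    fib (suc (suc (length (u ++ v)))) + fibValue (u ++ v)
      ≡⟨ cong₂ _+_ (trans (cong (fib ∘ suc) (length-++-suc u v)) (fib-+ (length v) (suc (length u))))
                   (fibValue-++ u v) ⟩
    (a * fib (suc (suc (length u))) + b * fib (suc (length u))) +
      (a * fibValue u + b * fibValue₁ u + fibValue v)
      ≡⟨ regroup a b _ _ _ _ _ ⟩
    a * (fib (suc (suc (length u))) + fibValue u) + b * fibValue₁ (true ∷ u) + fibValue v
      ≡⟨ cong (λ n → a * n + b * fibValue₁ (true ∷ u) + fibValue v) (sym (fibValue-true u)) ⟩
    a * fibValue (true ∷ u) + b * fibValue₁ (true ∷ u) + fibValue v ∎
    where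
    open ≡-Reasoning
    a = fib (suc (length v))
    b = fib (length v)

  fibValue₁-++ : ∀ u c v → fibValue₁ (u ++ c ∷ v) ≡
                 fib (suc (length v)) * fibValue u + fib (length v) * fibValue₁ u + fibValue₁ (c ∷ v)
  fibValue₁-++ [] c v = absorb (fib (suc (length v))) (fib (length v)) (fibValue₁ (c ∷ v))
  fibValue₁-++ (false ∷ u) c v = fibValue₁-++ u c v
  fibValue₁-++ (true ∷ u) c v = begin
    fib (suc (length (u ++ c ∷ v))) + fibValue₁ (u ++ c ∷ v)
      ≡⟨ cong₂ _+_ (trans (cong fib (length-++-suc u (c ∷ v))) (fib-+ (length v) (suc (length u))))
                   (fibValue₁-++ u c v) ⟩
    (a * fib (suc (suc (length u))) + b * fib (suc (length u))) +
      (a * fibValue u + b * fibValue₁ u + fibValue₁ (c ∷ v))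
      ≡⟨ regroup a b _ _ _ _ _ ⟩
    a * (fib (suc (suc (length u))) + fibValue u) + b * fibValue₁ (true ∷ u) + fibValue₁ (c ∷ v)
      ≡⟨ cong (λ n → a * n + b * fibValue₁ (true ∷ u) + fibValue₁ (c ∷ v)) (sym (fibValue-true u)) ⟩
    a * fibValue (true ∷ u) + b * fibValue₁ (true ∷ u) + fibValue₁ (c ∷ v) ∎
    where
    open ≡-Reasoning
    a = fib (suc (length v))
    b = fib (length v)

open Zeckendorf

module Recurrence where
  import Data.Nat as ℕ
  open import Data.Nat.Properties using (+-mono-≤; +-comm; +-assoc; <-irrefl)
  open import Data.Integer as ℤ using (ℤ; +_; 0ℤ; 1ℤ; -1ℤ; _+_; _*_; _-_; -_)
  open import Data.Integer.Properties
    using (pos-+; pos-*; -1*i≡-i; +-injective; i*j≡0⇒i≡0∨j≡0; +-identityˡ; *-zeroʳ)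
  open import Data.Integer.Tactic.RingSolver using (solve-∀)

  fib-cassini : ∀ n → + fib (suc (suc n)) * + fib n - + fib (suc n) * + fib (suc n) ≡ -1ℤ ℤ.^ suc n
  fib-cassini zero = refl
  fib-cassini (suc n) = begin
    + (F₂ ℕ.+ F₁) * b - + F₂ * + F₂
      ≡⟨ cong₂ (λ u w → u * b - w * w)
               (trans (pos-+ F₂ F₁) (cong (_+ b) (pos-+ F₁ F₀))) (pos-+ F₁ F₀) ⟩
    ((b + c) + b) * b - (b + c) * (b + c)
      ≡⟨ step b c ⟩
    - ((b + c) * c - b * b)
      ≡⟨ cong (λ u → - (u * c - b * b)) (sym (pos-+ F₁ F₀)) ⟩
    - (+ F₂ * c - b * b)
      ≡⟨ cong -_ (fib-cassini n) ⟩
    - (-1ℤ ℤ.^ suc n)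
      ≡⟨ sym (-1*i≡-i _) ⟩
    -1ℤ ℤ.^ suc (suc n) ∎
    where
    open ≡-Reasoning
    F₀ = fib n
    F₁ = fib (suc n)
    F₂ = fib (suc (suc n))
    b = + F₁
    c = + F₀
    step : ∀ b c → ((b + c) + b) * b - (b + c) * (b + c) ≡ - ((b + c) * c - b * b)
    step = solve-∀

  -1^even≡1 : ∀ e → -1ℤ ℤ.^ (e ℕ.* 2) ≡ 1ℤ
  -1^even≡1 zero = refl
  -1^even≡1 (suc e) = cong (λ u → -1ℤ * (-1ℤ * u)) (-1^even≡1 e)

  -- (E − 1)(E² − t E + s) h evaluated at 0, where E is the shift (E h) r = h (suc r).
  annihilator : ℤ → ℤ → (ℕ → ℤ) → ℤ
  annihilator t s h = h 3 - (t + 1ℤ) * h 2 + (t + s) * h 1 - s * h 0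

  annihilator-linear : ∀ t s a (f g h : ℕ → ℤ) → (∀ r → h r ≡ a * f r + g r) →
                       annihilator t s h ≡ a * annihilator t s f + annihilator t s g
  annihilator-linear t s a f g h h≡ rewrite h≡ 0 | h≡ 1 | h≡ 2 | h≡ 3 =
    linear t s a (f 0) (f 1) (f 2) (f 3) (g 0) (g 1) (g 2) (g 3)
    where
    linear : ∀ t s a f₀ f₁ f₂ f₃ g₀ g₁ g₂ g₃ →
      (a * f₃ + g₃) - (t + 1ℤ) * (a * f₂ + g₂) + (t + s) * (a * f₁ + g₁) - s * (a * f₀ + g₀)
      ≡ a * (f₃ - (t + 1ℤ) * f₂ + (t + s) * f₁ - s * f₀) +
        (g₃ - (t + 1ℤ) * g₂ + (t + s) * g₁ - s * g₀)
    linear = solve-∀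

  annihilator-progression : ∀ t s δ (g : ℕ → ℤ) → (∀ r → g (suc r) ≡ g r + δ) →
                            annihilator t s g ≡ δ * (1ℤ - t + s)
  annihilator-progression t s δ g step rewrite step 2 | step 1 | step 0 = progression t s δ (g 0)
    where
    progression : ∀ t s δ g₀ →
      ((g₀ + δ) + δ) + δ - (t + 1ℤ) * ((g₀ + δ) + δ) + (t + s) * (g₀ + δ) - s * g₀
      ≡ δ * (1ℤ - t + s)
    progression = solve-∀

  annihilator-orbit : ∀ (a b d c₁ c₂ α β κ : ℤ) (p q h : ℕ → ℤ) →
    (∀ r → p (suc r) ≡ a * p r + b * q r + c₁) →
    (∀ r → q (suc r) ≡ b * p r + d * q r + c₂) →
    (∀ r → h r ≡ α * p r + β * q r + κ) →
    annihilator (a + d) (a * d - b * b) h ≡ 0ℤ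
  annihilator-orbit a b d c₁ c₂ α β κ p q h p-step q-step h≡
    rewrite h≡ 0 | h≡ 1 | h≡ 2 | h≡ 3
          | p-step 2 | q-step 2 | p-step 1 | q-step 1 | p-step 0 | q-step 0
    = orbit a b d (p 0) (q 0) c₁ c₂ α β κ
    where
    orbit : ∀ (a b d p₀ q₀ c₁ c₂ α β κ : ℤ) →
      let p₁ = a * p₀ + b * q₀ + c₁
          q₁ = b * p₀ + d * q₀ + c₂
          p₂ = a * p₁ + b * q₁ + c₁
          q₂ = b * p₁ + d * q₁ + c₂
          p₃ = a * p₂ + b * q₂ + c₁
          q₃ = b * p₂ + d * q₂ + c₂
          h = λ p q → α * p + β * q + κ
          t = a + d
          s = a * d - b * b
      in h p₃ q₃ - (t + 1ℤ) * h p₂ q₂ + (t + s) * h p₁ q₁ - s * h p₀ q₀ ≡ 0ℤ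
    orbit = solve-∀

  private
    pos-affine : ∀ a p b q c → + (a ℕ.* p ℕ.+ b ℕ.* q ℕ.+ c) ≡ + a * + p + + b * + q + + c
    pos-affine a p b q c =
      trans (pos-+ (a ℕ.* p ℕ.+ b ℕ.* q) c)
            (cong (_+ + c) (trans (pos-+ (a ℕ.* p) (b ℕ.* q)) (cong₂ _+_ (pos-* a p) (pos-* b q))))

  -- Appending y moves (fibValue, fibValue₁) by an affine map whose linear part has
  -- trace F_{d+2} + F_d and, by Cassini, determinant (-1)^{d+1}.
  annihilator-pumped : ∀ x y z d → length y ≡ suc d →
    annihilator (+ fib (suc (suc d)) + + fib d) (-1ℤ ℤ.^ suc d) (λ r → + fibValue (x ++ y ^ r ++ z)) ≡ 0ℤ
  annihilator-pumped x y@(c ∷ y′) z d refl =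
    subst (λ s → annihilator (+ fib (suc (suc d)) + + fib d) s (λ r → + fibValue (x ++ y ^ r ++ z)) ≡ 0ℤ)
          (fib-cassini d)
          (annihilator-orbit (+ fib (suc (suc d))) (+ fib (suc d)) (+ fib d) (+ fibValue y) (+ fibValue₁ y)
                             (+ fib (suc (length z))) (+ fib (length z)) (+ fibValue z)
                             p q (λ r → + fibValue (x ++ y ^ r ++ z)) p-step q-step h≡)
    where
    p q : ℕ → ℤ
    p r = + fibValue (x ++ y ^ r)
    q r = + fibValue₁ (x ++ y ^ r)
    append : ∀ r → x ++ y ^ suc r ≡ (x ++ y ^ r) ++ y
    append r = trans (cong (x ++_) (^-suc y r)) (sym (++-assoc x (y ^ r) y))
    p-step : ∀ r → p (suc r) ≡ + fib (suc (suc d)) * p r + + fib (suc d) * q r + + fibValue y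
    p-step r = trans (cong (+_ ∘ fibValue) (append r))
                     (trans (cong +_ (fibValue-++ (x ++ y ^ r) y))
                            (pos-affine (fib (suc (suc d))) _ (fib (suc d)) _ (fibValue y)))
    q-step : ∀ r → q (suc r) ≡ + fib (suc d) * p r + + fib d * q r + + fibValue₁ y
    q-step r = trans (cong (+_ ∘ fibValue₁) (append r))
                     (trans (cong +_ (fibValue₁-++ (x ++ y ^ r) c y′))
                            (pos-affine (fib (suc d)) _ (fib d) _ (fibValue₁ y)))
    h≡ : ∀ r → + fibValue (x ++ y ^ r ++ z) ≡
               + fib (suc (length z)) * p r + + fib (length z) * q r + + fibValue z
    h≡ r = trans (cong (+_ ∘ fibValue) (sym (++-assoc x (y ^ r) z)))
                 (trans (cong +_ (fibValue-++ (x ++ y ^ r) z))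
                        (pos-affine (fib (suc (length z))) _ (fib (length z)) _ (fibValue z)))

  record PumpedGap : Set where
    field
      x y z x′ y′ z′ : List Bool
      a c δ e : ℕ
      length-y  : length y ≡ suc e ℕ.* 2
      length-y′ : length y′ ≡ suc e ℕ.* 2
      values : ∀ r → fibValue (x′ ++ y′ ^ r ++ z′) ≡
                     a ℕ.* fibValue (x ++ y ^ r ++ z) ℕ.+ (c ℕ.+ r ℕ.* δ)

  pumped-gap-constant : (G : PumpedGap) → PumpedGap.δ G ≡ 0
  pumped-gap-constant G = [ +-injective , ⊥-elim ∘ 1-t+1≢0 ]′ (i*j≡0⇒i≡0∨j≡0 (+ δ) drift≡0)
    where
    open PumpedGap G
    d = suc (e ℕ.* 2)
    t = + fib (suc (suc d)) + + fib d
    m n g : ℕ → ℤ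
    m r = + fibValue (x ++ y ^ r ++ z)
    n r = + fibValue (x′ ++ y′ ^ r ++ z′)
    g r = + (c ℕ.+ r ℕ.* δ)
    even-annihilator : ∀ u v w → length v ≡ suc d →
                       annihilator t 1ℤ (λ r → + fibValue (u ++ v ^ r ++ w)) ≡ 0ℤ
    even-annihilator u v w |v| =
      subst (λ s → annihilator t s (λ r → + fibValue (u ++ v ^ r ++ w)) ≡ 0ℤ) (-1^even≡1 (suc e))
            (annihilator-pumped u v w d |v|)
    g-step : ∀ r → g (suc r) ≡ g r + + δ
    g-step r = trans (cong +_ (trans (cong (c ℕ.+_) (+-comm δ (r ℕ.* δ))) (sym (+-assoc c (r ℕ.* δ) δ))))
                     (pos-+ (c ℕ.+ r ℕ.* δ) δ)
    n≡ : ∀ r → n r ≡ + a * m r + g r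
    n≡ r = trans (cong +_ (values r))
                 (trans (pos-+ (a ℕ.* fibValue (x ++ y ^ r ++ z)) _) (cong (_+ g r) (pos-* a _)))
    drift≡0 : + δ * (1ℤ - t + 1ℤ) ≡ 0ℤ
    drift≡0 = begin
      + δ * (1ℤ - t + 1ℤ)                            ≡⟨ sym (annihilator-progression t 1ℤ (+ δ) g g-step) ⟩
      annihilator t 1ℤ g                             ≡⟨ sym (+-identityˡ _) ⟩
      0ℤ + annihilator t 1ℤ g                        ≡⟨ cong (_+ annihilator t 1ℤ g) a*0 ⟩
      + a * annihilator t 1ℤ m + annihilator t 1ℤ g  ≡⟨ sym (annihilator-linear t 1ℤ (+ a) m g n n≡) ⟩
      annihilator t 1ℤ n                             ≡⟨ even-annihilator x′ y′ z′ length-y′ ⟩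
      0ℤ                                             ∎
      where
      open ≡-Reasoning
      a*0 : 0ℤ ≡ + a * annihilator t 1ℤ m
      a*0 = sym (trans (cong (+ a *_) (even-annihilator x y z length-y)) (*-zeroʳ (+ a)))
    1-t+1≢0 : 1ℤ - t + 1ℤ ≢ 0ℤ
    1-t+1≢0 eq = <-irrefl refl (subst (2 ℕ.<_) trace≡2 2<trace)
      where
      2<trace : 2 ℕ.< fib (suc (suc d)) ℕ.+ fib d
      2<trace = +-mono-≤ (fib-mono-≤ {3} {suc (suc d)} (s≤s (s≤s (s≤s z≤n)))) (fib-suc-pos (e ℕ.* 2))
      t≡2 : ∀ t → t ≡ + 2 - (1ℤ - t + 1ℤ)
      t≡2 = solve-∀
      trace≡2 : fib (suc (suc d)) ℕ.+ fib d ≡ 2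
      trace≡2 = +-injective
        (trans (pos-+ (fib (suc (suc d))) (fib d)) (trans (t≡2 t) (cong (λ u → + 2 - u) eq)))

module Representation (rep : ℕ → List Bool) (zr : ZeckRep rep) where
  open import Data.Nat using (_+_; _∸_)
  open import Data.Nat.Properties
  open import Data.Nat.Tactic.RingSolver using (solve-∀)

  rep-unique : ∀ {w n} → IsZeck w n → rep n ≡ w
  rep-unique = zeck-unique (zr _)

  rep-fibValue : ∀ v → NoConsecOnes v → ∃ λ z → v ≡ replicate z false ++ rep (fibValue v)
  rep-fibValue v h with strip-zeros v
  ... | z , u , refl , u-lead =
    z , cong (replicate z false ++_) (sym (rep-unique (u-lead , no11-pad⁻ z u h , sym (fibValue-pad z u))))

  ftm-fibValue : ∀ v → NoConsecOnes v → ftm rep (fibValue v) ≡ parity (ones v)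
  ftm-fibValue v h with rep-fibValue v h
  ... | z , v≡ = cong parity (trans (sym (ones-pad z _)) (cong ones (sym v≡)))

  rep-length-≤ : ∀ {n} k → n < fib (suc (suc k)) → length (rep n) ≤ k
  rep-length-≤ {n} k = zeck-length-≤ {rep n} k (zr n)

  padded-rep : ∀ k i → i < fib (suc k) →
               ∃ λ w → length w ≡ k × NoConsecOnes (true ∷ w) × fibValue w ≡ i
  padded-rep zero zero _ = [] , refl , tt , refl
  padded-rep zero (suc i) (s≤s ())
  padded-rep (suc k) i i<fib =
    false ∷ replicate (k ∸ length (rep i)) false ++ rep i ,
    cong suc (trans (length-pad _ (rep i)) (m∸n+n≡m (rep-length-≤ k i<fib))) ,
    no11-pad⁺ z (rep i) (proj₁ (proj₂ (zr i))) ,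
    trans (fibValue-pad z (rep i)) (proj₂ (proj₂ (zr i)))
    where z = k ∸ length (rep i)

  parity-suc : ∀ n → parity (suc n) + parity n ≡ 1
  parity-suc zero = refl
  parity-suc (suc zero) = refl
  parity-suc (suc (suc n)) = parity-suc n

  ftm-flip : ∀ k i → i < fib (suc k) → ftm rep (fib (suc (suc k)) + i) + ftm rep i ≡ 1
  ftm-flip k i i<fib with padded-rep k i i<fib
  ... | w , refl , h , refl = begin
    ftm rep (fib (suc (suc (length w))) + fibValue w) + ftm rep (fibValue w)
      ≡⟨ cong₂ _+_ (trans (cong (ftm rep) (sym (fibValue-true w))) (ftm-fibValue (true ∷ w) h))
                   (ftm-fibValue w (no11-∷⁻ true w h)) ⟩
    parity (suc (ones w)) + parity (ones w)
      ≡⟨ parity-suc (ones w) ⟩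
    1 ∎
    where open ≡-Reasoning

  ftmSum : ℕ → ℕ
  ftmSum zero = 0
  ftmSum (suc x) = ftmSum x + ftm rep x

  sumFtm≡ftmSum : ∀ n → sumFtm rep n ≡ ftmSum (suc n)
  sumFtm≡ftmSum zero = refl
  sumFtm≡ftmSum (suc n) = cong (_+ ftm rep (suc n)) (sumFtm≡ftmSum n)

  ftmSum-block : ∀ k i → i ≤ fib (suc k) →
                 ftmSum (fib (suc (suc k)) + i) + ftmSum i ≡ ftmSum (fib (suc (suc k))) + i
  ftmSum-block k zero _ = cong (λ n → ftmSum n + 0) (+-identityʳ (fib (suc (suc k))))
  ftmSum-block k (suc i) i<fib = begin
    ftmSum (F + suc i) + ftmSum (suc i)
      ≡⟨ cong (λ n → ftmSum n + ftmSum (suc i)) (+-suc F i) ⟩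
    (ftmSum (F + i) + ftm rep (F + i)) + (ftmSum i + ftm rep i)
      ≡⟨ interchange (ftmSum (F + i)) _ _ _ ⟩
    (ftmSum (F + i) + ftmSum i) + (ftm rep (F + i) + ftm rep i)
      ≡⟨ cong₂ _+_ (ftmSum-block k i (<⇒≤ i<fib)) (ftm-flip k i i<fib) ⟩
    (ftmSum F + i) + 1
      ≡⟨ trans (+-assoc (ftmSum F) i 1) (cong (ftmSum F +_) (+-comm i 1)) ⟩
    ftmSum F + suc i ∎
    where
    open ≡-Reasoning
    F = fib (suc (suc k))
    interchange : ∀ a b c d → (a + b) + (c + d) ≡ (a + c) + (b + d)
    interchange = solve-∀

block : List Bool
block = true ∷ false ∷ false ∷ true ∷ false ∷ false ∷ []

block^-no11 : ∀ M → NoConsecOnes (block ^ M)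
block^-no11 zero = tt
block^-no11 (suc M) = block^-no11 M

block^-zeck : ∀ M → IsZeck (block ^ M) (fibValue (block ^ M))
block^-zeck zero = tt , tt , refl
block^-zeck (suc M) = tt , block^-no11 (suc M) , refl

parity-ones-block^ : ∀ M → parity (ones (block ^ M)) ≡ 0
parity-ones-block^ zero = refl
parity-ones-block^ (suc M) = parity-ones-block^ M

module Discrepancy (rep : ℕ → List Bool) (zr : ZeckRep rep) where
  import Data.Nat as ℕ
  open import Data.Nat.Properties using (≤-refl; ≤-trans; <⇒≤; n≤1+n; +-identityʳ)
  open import Data.Integer using (ℤ; +_; 1ℤ; -1ℤ; _+_; _*_; _-_; -_)
  open import Data.Integer.Properties using (pos-+; pos-*; neg-involutive; +-injective)
  open import Data.Integer.Tactic.RingSolver using (solve-∀)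
  open Representation rep zr

  discrepancy : ℕ → ℤ
  discrepancy x = + (2 ℕ.* ftmSum x) - + x

  discrepancy-block : ∀ k i → i ≤ fib (suc k) →
    discrepancy (fib (suc (suc k)) ℕ.+ i) ≡ discrepancy (fib (suc (suc k))) - discrepancy i
  discrepancy-block k i i≤fib = begin
    + (2 ℕ.* a) - + (F ℕ.+ i)                   ≡⟨ cong₂ _-_ (pos-* 2 a) (pos-+ F i) ⟩
    + 2 * + a - (+ F + + i)                      ≡⟨ cong (λ u → + 2 * u - (+ F + + i)) a≡ ⟩
    + 2 * ((+ c + + i) - + b) - (+ F + + i)      ≡⟨ rearrange (+ c) (+ i) (+ b) (+ F) ⟩
    (+ 2 * + c - + F) - (+ 2 * + b - + i)
      ≡⟨ sym (cong₂ (λ u w → (u - + F) - (w - + i)) (pos-* 2 c) (pos-* 2 b)) ⟩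
    (+ (2 ℕ.* c) - + F) - (+ (2 ℕ.* b) - + i)    ∎
    where
    open ≡-Reasoning
    F = fib (suc (suc k))
    a = ftmSum (F ℕ.+ i)
    b = ftmSum i
    c = ftmSum F
    cancel : ∀ a b → a ≡ (a + b) - b
    cancel = solve-∀
    a≡ : + a ≡ (+ c + + i) - + b
    a≡ = trans (cancel (+ a) (+ b))
               (cong (_- + b) (trans (sym (pos-+ a b)) (trans (cong +_ (ftmSum-block k i i≤fib)) (pos-+ c i))))
    rearrange : ∀ c i b F → + 2 * ((c + i) - b) - (F + i) ≡ (+ 2 * c - F) - (+ 2 * b - i)
    rearrange = solve-∀

  discrepancy-fib-antiperiodic : ∀ k →
    discrepancy (fib (suc (suc (suc (suc k))))) ≡ - discrepancy (fib (suc k))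
  discrepancy-fib-antiperiodic k = begin
    d₄                 ≡⟨ discrepancy-block (suc k) (fib (suc (suc k))) ≤-refl ⟩
    d₃ - d₂            ≡⟨ cong (_- d₂) (discrepancy-block k (fib (suc k)) ≤-refl) ⟩
    (d₂ - d₁) - d₂     ≡⟨ cancel d₂ d₁ ⟩
    - d₁               ∎
    where
    open ≡-Reasoning
    d₁ = discrepancy (fib (suc k))
    d₂ = discrepancy (fib (suc (suc k)))
    d₃ = discrepancy (fib (suc (suc (suc k))))
    d₄ = discrepancy (fib (suc (suc (suc (suc k)))))
    cancel : ∀ a b → (a - b) - a ≡ - b
    cancel = solve-∀

  discrepancy-fib-6M+1 : ∀ M → discrepancy (fib (suc (M ℕ.* 6))) ≡ -1ℤ
  discrepancy-fib-6M+1 zero rewrite rep-unique {[]} {0} (tt , tt , refl) = refl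
  discrepancy-fib-6M+1 (suc M) = begin
    discrepancy (fib (suc (suc (suc (suc (suc (suc (suc (M ℕ.* 6)))))))))
      ≡⟨ discrepancy-fib-antiperiodic (suc (suc (suc (M ℕ.* 6)))) ⟩
    - discrepancy (fib (suc (suc (suc (suc (M ℕ.* 6))))))
      ≡⟨ cong -_ (discrepancy-fib-antiperiodic (M ℕ.* 6)) ⟩
    - - discrepancy (fib (suc (M ℕ.* 6)))
      ≡⟨ neg-involutive _ ⟩
    discrepancy (fib (suc (M ℕ.* 6)))
      ≡⟨ discrepancy-fib-6M+1 M ⟩
    -1ℤ ∎
    where open ≡-Reasoning

  discrepancy-fib-6M+4 : ∀ M → discrepancy (fib (suc (suc (suc (suc (M ℕ.* 6)))))) ≡ 1ℤ
  discrepancy-fib-6M+4 M = trans (discrepancy-fib-antiperiodic (M ℕ.* 6)) (cong -_ (discrepancy-fib-6M+1 M))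

  fibValue-block^-suc : ∀ M → fibValue (block ^ suc M) ≡
    fib (7 ℕ.+ length (block ^ M)) ℕ.+ (fib (4 ℕ.+ length (block ^ M)) ℕ.+ fibValue (block ^ M))
  fibValue-block^-suc M =
    trans (fibValue-true (false ∷ false ∷ true ∷ false ∷ false ∷ block ^ M))
          (cong (fib (7 ℕ.+ length (block ^ M)) ℕ.+_) (fibValue-true (false ∷ false ∷ block ^ M)))

  discrepancy-blocks : ∀ M → discrepancy (fibValue (block ^ M)) ≡ - + (2 ℕ.* M)
  discrepancy-blocks zero = refl
  discrepancy-blocks (suc M) = begin
    discrepancy (fibValue (block ^ suc M))
      ≡⟨ cong discrepancy (fibValue-block^-suc M) ⟩
    discrepancy (fib (7 ℕ.+ L) ℕ.+ (fib (4 ℕ.+ L) ℕ.+ N))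
      ≡⟨ discrepancy-block (5 ℕ.+ L) _ tail≤fib ⟩
    discrepancy (fib (7 ℕ.+ L)) - discrepancy (fib (4 ℕ.+ L) ℕ.+ N)
      ≡⟨ cong (λ u → discrepancy (fib (7 ℕ.+ L)) - u) (discrepancy-block (2 ℕ.+ L) N N≤fib) ⟩
    discrepancy (fib (7 ℕ.+ L)) - (discrepancy (fib (4 ℕ.+ L)) - discrepancy N)
      ≡⟨ cong (λ n → discrepancy (fib (7 ℕ.+ n)) - (discrepancy (fib (4 ℕ.+ n)) - discrepancy N))
              (length-^ block M) ⟩
    discrepancy (fib (7 ℕ.+ M ℕ.* 6)) - (discrepancy (fib (4 ℕ.+ M ℕ.* 6)) - discrepancy N)
      ≡⟨ cong₂ (λ u w → u - (w - discrepancy N))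
               (discrepancy-fib-6M+1 (suc M)) (discrepancy-fib-6M+4 M) ⟩
    -1ℤ - (1ℤ - discrepancy N)
      ≡⟨ cong (λ u → -1ℤ - (1ℤ - u)) (trans (discrepancy-blocks M) (cong -_ (pos-* 2 M))) ⟩
    -1ℤ - (1ℤ - - (+ 2 * + M))
      ≡⟨ step (+ M) ⟩
    - (+ 2 * (1ℤ + + M))
      ≡⟨ cong -_ (sym (pos-* 2 (suc M))) ⟩
    - + (2 ℕ.* suc M) ∎
    where
    open ≡-Reasoning
    L = length (block ^ M)
    N = fibValue (block ^ M)
    N<fib : N ℕ.< fib (2 ℕ.+ L)
    N<fib = fibValue-< (block ^ M) (block^-no11 M)
    N≤fib : N ≤ fib (3 ℕ.+ L)
    N≤fib = ≤-trans (<⇒≤ N<fib) (fib-mono-≤ (n≤1+n (2 ℕ.+ L)))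
    tail≤fib : fib (4 ℕ.+ L) ℕ.+ N ≤ fib (6 ℕ.+ L)
    tail≤fib = ≤-trans (<⇒≤ (subst (ℕ._< fib (5 ℕ.+ L)) (fibValue-true (false ∷ false ∷ block ^ M))
                                   (fibValue-< (true ∷ false ∷ false ∷ block ^ M) (block^-no11 M))))
                       (fib-mono-≤ (n≤1+n (5 ℕ.+ L)))
    step : ∀ m → -1ℤ - (1ℤ - - (+ 2 * m)) ≡ - (+ 2 * (1ℤ + m))
    step = solve-∀

  sumFtm-blocks : ∀ M → fibValue (block ^ M) ≡ 2 ℕ.* sumFtm rep (fibValue (block ^ M)) ℕ.+ 2 ℕ.* M
  sumFtm-blocks M = +-injective (begin
    + N                                  ≡⟨ unfold (+ (2 ℕ.* s)) (+ N) ⟩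
    + (2 ℕ.* s) - (+ (2 ℕ.* s) - + N)    ≡⟨ cong (λ u → + (2 ℕ.* s) - u) (discrepancy-blocks M) ⟩
    + (2 ℕ.* s) + - - + (2 ℕ.* M)        ≡⟨ cong (λ u → + (2 ℕ.* s) + u) (neg-involutive (+ (2 ℕ.* M))) ⟩
    + (2 ℕ.* s) + + (2 ℕ.* M)            ≡⟨ sym (pos-+ (2 ℕ.* s) _) ⟩
    + (2 ℕ.* s ℕ.+ 2 ℕ.* M)              ≡⟨ cong (λ n → + (2 ℕ.* n ℕ.+ 2 ℕ.* M)) s≡sumFtm ⟩
    + (2 ℕ.* sumFtm rep N ℕ.+ 2 ℕ.* M)   ∎)
    where
    open ≡-Reasoning
    N = fibValue (block ^ M)
    s = ftmSum N
    unfold : ∀ u n → n ≡ u - (u - n)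
    unfold = solve-∀
    s≡sumFtm : s ≡ sumFtm rep N
    s≡sumFtm = sym (trans (sumFtm≡ftmSum N)
                 (trans (cong (s ℕ.+_) (trans (ftm-fibValue (block ^ M) (block^-no11 M)) (parity-ones-block^ M)))
                        (+-identityʳ s)))

module Automata where
  open import Data.Nat using (_+_; _*_; _∸_)
  open import Data.Nat.Properties
  open import Data.Nat.Tactic.RingSolver using (solve-∀)
  open import Data.Fin using (Fin; toℕ; _↑ˡ_; _↑ʳ_; splitAt)
  open import Data.Fin.Properties
    using (pigeonhole; toℕ<n; ↑ˡ-injective; ↑ʳ-injective; splitAt-↑ˡ; splitAt-↑ʳ)
  open DFA

  run-++ : ∀ (A : DFA) q u w → run A q (u ++ w) ≡ run A (run A q u) w
  run-++ A q [] w = refl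
  run-++ A q (c ∷ u) w = run-++ A (step A q c) u w

  run-^ : ∀ (A : DFA) q w → run A q w ≡ q → ∀ r → run A q (w ^ r) ≡ q
  run-^ A q w loop zero = refl
  run-^ A q w loop (suc r) =
    trans (run-++ A q w (w ^ r)) (trans (cong (λ q′ → run A q′ (w ^ r)) loop) (run-^ A q w loop r))

  run-pumped : ∀ (A : DFA) q X Y Z → run A q (X ++ Y) ≡ run A q X →
               ∀ r → run A q (X ++ Y ^ r ++ Z) ≡ run A q (X ++ Z)
  run-pumped A q X Y Z loop r = begin
    run A q (X ++ Y ^ r ++ Z)               ≡⟨ run-++ A q X (Y ^ r ++ Z) ⟩
    run A (run A q X) (Y ^ r ++ Z)          ≡⟨ run-++ A (run A q X) (Y ^ r) Z ⟩
    run A (run A (run A q X) (Y ^ r)) Z     ≡⟨ cong (λ q′ → run A q′ Z) (run-^ A (run A q X) Y Y-loop r) ⟩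
    run A (run A q X) Z                     ≡⟨ sym (run-++ A q X Z) ⟩
    run A q (X ++ Z)                        ∎
    where
    open ≡-Reasoning
    Y-loop = trans (sym (run-++ A q X Y)) loop

  colour : ∀ {n} → Fin n → Bool → Fin (n + n)
  colour {n} q false = q ↑ˡ n
  colour {n} q true = n ↑ʳ q

  colour-injective : ∀ {n} (q q′ : Fin n) c c′ → colour q c ≡ colour q′ c′ → q ≡ q′ × c ≡ c′
  colour-injective {n} q q′ false false e = ↑ˡ-injective n q q′ e , refl
  colour-injective {n} q q′ true true e = ↑ʳ-injective n q q′ e , refl
  colour-injective {n} q q′ false true e
    with () ← trans (sym (splitAt-↑ˡ n q n)) (trans (cong (splitAt n) e) (splitAt-↑ʳ n n q′))
  colour-injective {n} q q′ true false e
    with () ← trans (sym (splitAt-↑ʳ n n q)) (trans (cong (splitAt n) e) (splitAt-↑ˡ n q′ n))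

  record Pumping (A : DFA) (b : List Bool) : Set where
    field
      i ℓ k : ℕ
      x y z : List Bool
      0<ℓ : 0 < ℓ
      length-y : length y ≡ ℓ * length b
      length-pumped : ∀ r → length (x ++ y ^ r ++ z) ≡ length (b ^ (i + r * ℓ + k))
      no11-pumped : ∀ r → NoConsecOnes (x ++ y ^ r ++ z)
      accepts-pumped : ∀ r → Accepts A (zip (b ^ (i + r * ℓ + k)) (x ++ y ^ r ++ z))

  pumping-from-loop : ∀ (A : DFA) b i ℓ k x y z → 0 < ℓ →
         length x ≡ i * length b → length y ≡ ℓ * length b → length z ≡ k * length b →
         run A (start A) (zip (b ^ i) x ++ zip (b ^ ℓ) y) ≡ run A (start A) (zip (b ^ i) x) →
         lastBit false (x ++ y) ≡ lastBit false x →
         NoConsecOnes (x ++ y ++ z) →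
         Accepts A (zip (b ^ i) x ++ zip (b ^ ℓ) y ++ zip (b ^ k) z) →
         Pumping A b
  pumping-from-loop A b i ℓ k x y z 0<ℓ |x| |y| |z| state-loop bit-loop no11 accepts = record
    { i = i ; ℓ = ℓ ; k = k ; x = x ; y = y ; z = z ; 0<ℓ = 0<ℓ ; length-y = |y|
    ; length-pumped = length-pumped
    ; no11-pumped = no11-pump x y z bit-loop no11
    ; accepts-pumped = accepts-pumped
    }
    where
    X = zip (b ^ i) x
    Y = zip (b ^ ℓ) y
    Z = zip (b ^ k) z
    |bⁱ| : length (b ^ i) ≡ length x
    |bⁱ| = trans (length-^ b i) (sym |x|)
    |bˡ| : length (b ^ ℓ) ≡ length y
    |bˡ| = trans (length-^ b ℓ) (sym |y|)
    |bᵏ| : length (b ^ k) ≡ length z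
    |bᵏ| = trans (length-^ b k) (sym |z|)
    |bˡʳ| : ∀ r → length ((b ^ ℓ) ^ r) ≡ length (y ^ r)
    |bˡʳ| r = trans (length-^ (b ^ ℓ) r) (trans (cong (r *_) |bˡ|) (sym (length-^ y r)))
    zip-pumped : ∀ r → zip (b ^ (i + r * ℓ + k)) (x ++ y ^ r ++ z) ≡ X ++ Y ^ r ++ Z
    zip-pumped r = begin
      zip (b ^ (i + r * ℓ + k)) (x ++ y ^ r ++ z)
        ≡⟨ cong (λ a → zip a (x ++ y ^ r ++ z)) (^-pumped b i r ℓ k) ⟩
      zip (b ^ i ++ (b ^ ℓ) ^ r ++ b ^ k) (x ++ y ^ r ++ z)
        ≡⟨ zip-++ (b ^ i) _ x _ |bⁱ| ⟩
      X ++ zip ((b ^ ℓ) ^ r ++ b ^ k) (y ^ r ++ z)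
        ≡⟨ cong (X ++_) (zip-++ ((b ^ ℓ) ^ r) _ (y ^ r) _ (|bˡʳ| r)) ⟩
      X ++ zip ((b ^ ℓ) ^ r) (y ^ r) ++ Z
        ≡⟨ cong (λ W → X ++ W ++ Z) (zip-^ (b ^ ℓ) y |bˡ| r) ⟩
      X ++ Y ^ r ++ Z ∎
      where open ≡-Reasoning
    accepts-pumped : ∀ r → Accepts A (zip (b ^ (i + r * ℓ + k)) (x ++ y ^ r ++ z))
    accepts-pumped r = subst (Accepts A) (sym (zip-pumped r))
      (subst (T ∘ accept A) (trans (run-pumped A (start A) X Y Z state-loop 1)
                                   (sym (run-pumped A (start A) X Y Z state-loop r)))
        (subst (Accepts A) (cong (λ W → X ++ W ++ Z) (sym (++-identityʳ Y))) accepts))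
    length-pumped : ∀ r → length (x ++ y ^ r ++ z) ≡ length (b ^ (i + r * ℓ + k))
    length-pumped r = sym (begin
      length (b ^ (i + r * ℓ + k))                    ≡⟨ cong length (^-pumped b i r ℓ k) ⟩
      length (b ^ i ++ (b ^ ℓ) ^ r ++ b ^ k)          ≡⟨ length-++ (b ^ i) ⟩
      length (b ^ i) + length ((b ^ ℓ) ^ r ++ b ^ k)  ≡⟨ cong (length (b ^ i) +_) (length-++ ((b ^ ℓ) ^ r)) ⟩
      length (b ^ i) + (length ((b ^ ℓ) ^ r) + length (b ^ k))
        ≡⟨ cong₂ _+_ |bⁱ| (cong₂ _+_ (|bˡʳ| r) |bᵏ|) ⟩
      length x + (length (y ^ r) + length z)          ≡⟨ cong (length x +_) (sym (length-++ (y ^ r))) ⟩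
      length x + length (y ^ r ++ z)                  ≡⟨ sym (length-++ x) ⟩
      length (x ++ y ^ r ++ z)                        ∎)
      where open ≡-Reasoning

  prefixState : (A : DFA) (b v : List Bool) → ℕ → Fin (size A)
  prefixState A b v n = run A (start A) (zip (b ^ n) (take (n * length b) v))

  prefixBit : (b v : List Bool) → ℕ → Bool
  prefixBit b v n = lastBit false (take (n * length b) v)

  prefixColour : (A : DFA) (b v : List Bool) (J : ℕ) → Fin J → Fin (size A + size A)
  prefixColour A b v J p = colour (prefixState A b v (toℕ p)) (prefixBit b v (toℕ p))

  private
    distrib : ∀ I ℓ k L → (I + ℓ + k) * L ≡ I * L + (ℓ * L + k * L)
    distrib = solve-∀

  pumping-at-blocks : ∀ (A : DFA) b v I ℓ k → 0 < ℓ →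
    length v ≡ (I + ℓ + k) * length b → NoConsecOnes v → Accepts A (zip (b ^ (I + ℓ + k)) v) →
    prefixState A b v (I + ℓ) ≡ prefixState A b v I → prefixBit b v (I + ℓ) ≡ prefixBit b v I →
    Pumping A b
  pumping-at-blocks A b v I ℓ k 0<ℓ |v| no11 accepts state-loop bit-loop
    with split-length (I * length b) (ℓ * length b + k * length b) v (trans |v| (distrib I ℓ k (length b)))
  ... | x , w , refl , |x| , |w| with split-length (ℓ * length b) (k * length b) w |w|
  ... | y , z , refl , |y| , |z| =
    pumping-from-loop A b I ℓ k x y z 0<ℓ |x| |y| |z|
      (subst₂ (λ u u′ → run A (start A) u ≡ run A (start A) u′) zip-xy zip-x state-loop)
      (subst₂ (λ u u′ → lastBit false u ≡ lastBit false u′) take-xy take-x bit-loop)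
      no11
      (subst (Accepts A) zip-xyz accepts)
    where
    |bⁱ| = trans (length-^ b I) (sym |x|)
    |bˡ| = trans (length-^ b ℓ) (sym |y|)
    take-x : take (I * length b) (x ++ y ++ z) ≡ x
    take-x = subst (λ n → take n (x ++ y ++ z) ≡ x) |x| (take-length-++ x (y ++ z))
    take-xy : take ((I + ℓ) * length b) (x ++ y ++ z) ≡ x ++ y
    take-xy = subst₂ (λ n u → take n u ≡ x ++ y)
                (trans (length-++ x) (trans (cong₂ _+_ |x| |y|) (sym (*-distribʳ-+ (length b) I ℓ))))
                (++-assoc x y z)
                (take-length-++ (x ++ y) z)
    zip-x : zip (b ^ I) (take (I * length b) (x ++ y ++ z)) ≡ zip (b ^ I) x
    zip-x = cong (zip (b ^ I)) take-x
    zip-xy : zip (b ^ (I + ℓ)) (take ((I + ℓ) * length b) (x ++ y ++ z)) ≡ zip (b ^ I) x ++ zip (b ^ ℓ) y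
    zip-xy = trans (cong₂ zip (^-+ b I ℓ) take-xy) (zip-++ (b ^ I) _ x _ |bⁱ|)
    zip-xyz : zip (b ^ (I + ℓ + k)) (x ++ y ++ z) ≡ zip (b ^ I) x ++ zip (b ^ ℓ) y ++ zip (b ^ k) z
    zip-xyz = begin
      zip (b ^ (I + ℓ + k)) (x ++ y ++ z)
        ≡⟨ cong (λ a → zip a (x ++ y ++ z)) (^-+ b (I + ℓ) k) ⟩
      zip (b ^ (I + ℓ) ++ b ^ k) (x ++ y ++ z)
        ≡⟨ cong (λ a → zip (a ++ b ^ k) (x ++ y ++ z)) (^-+ b I ℓ) ⟩
      zip ((b ^ I ++ b ^ ℓ) ++ b ^ k) (x ++ y ++ z)
        ≡⟨ cong (λ a → zip a (x ++ y ++ z)) (++-assoc (b ^ I) _ _) ⟩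
      zip (b ^ I ++ b ^ ℓ ++ b ^ k) (x ++ y ++ z)
        ≡⟨ zip-++ (b ^ I) _ x _ |bⁱ| ⟩
      zip (b ^ I) x ++ zip (b ^ ℓ ++ b ^ k) (y ++ z)
        ≡⟨ cong (zip (b ^ I) x ++_) (zip-++ (b ^ ℓ) _ y _ |bˡ|) ⟩
      zip (b ^ I) x ++ zip (b ^ ℓ) y ++ zip (b ^ k) z ∎
      where open ≡-Reasoning

  pumping : ∀ (A : DFA) b v J → size A + size A < J → length v ≡ J * length b →
            NoConsecOnes v → Accepts A (zip (b ^ J) v) → Pumping A b
  pumping A b v J N<J |v| no11 accepts with pigeonhole N<J (prefixColour A b v J)
  ... | i , j , i<j , same =
    pumping-at-blocks A b v I ℓ k (m<n⇒0<n∸m i<j)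
      (trans |v| (cong (_* length b) (sym J≡)))
      no11
      (subst (λ n → Accepts A (zip (b ^ n) v)) (sym J≡) accepts)
      (subst (λ n → prefixState A b v n ≡ prefixState A b v I) (sym I+ℓ≡j) (sym (proj₁ same′)))
      (subst (λ n → prefixBit b v n ≡ prefixBit b v I) (sym I+ℓ≡j) (sym (proj₂ same′)))
    where
    I = toℕ i
    ℓ = toℕ j ∸ I
    k = J ∸ toℕ j
    I+ℓ≡j : I + ℓ ≡ toℕ j
    I+ℓ≡j = m+[n∸m]≡n (<⇒≤ i<j)
    J≡ : I + ℓ + k ≡ J
    J≡ = trans (cong (_+ k) I+ℓ≡j) (m+[n∸m]≡n (<⇒≤ (toℕ<n j)))
    same′ = colour-injective _ _ _ _ same

module SynchronisedSum (rep : ℕ → List Bool) (zr : ZeckRep rep) where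
  open import Data.Nat using (_+_; _*_; _∸_)
  open import Data.Nat.Properties
  open import Data.Nat.Tactic.RingSolver using (solve-∀)
  open import Function.Bundles using (_⇔_; Equivalence)
  open Representation rep zr
  open Discrepancy rep zr using (sumFtm-blocks)
  open Recurrence using (PumpedGap)
  open Automata

  padPair-zip : ∀ u w z → length u ≡ z + length w → padPair u w ≡ zip u (replicate z false ++ w)
  padPair-zip u w z |u| rewrite m≥n⇒m⊔n≡m (subst (length w ≤_) (sym |u|) (m≤n+m (length w) z))
                              | n∸n≡0 (length u) | |u| | m+n∸n≡m z (length w) = refl

  module _ (A : DFA) (f : ℕ → ℕ)
           (sync : ∀ n m → Accepts A (padPair (rep n) (rep m)) ⇔ (m ≡ f n)) where

    sync-accepts : ∀ n → length (rep (f n)) ≤ length (rep n) →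
      Accepts A (zip (rep n) (replicate (length (rep n) ∸ length (rep (f n))) false ++ rep (f n)))
    sync-accepts n shorter =
      subst (Accepts A) (padPair-zip (rep n) (rep (f n)) _ (sym (m∸n+n≡m shorter)))
            (Equivalence.from (sync n (f n)) refl)

    sync-accepted : ∀ n v → NoConsecOnes v → length v ≡ length (rep n) → Accepts A (zip (rep n) v) →
                    fibValue v ≡ f n
    sync-accepted n v h |v| accepts with rep-fibValue v h
    ... | z , v≡ = Equivalence.to (sync n (fibValue v))
      (subst (Accepts A) (sym (trans (padPair-zip (rep n) _ z |repₙ|) (cong (zip (rep n)) (sym v≡)))) accepts)
      where
      |repₙ| : length (rep n) ≡ z + length (rep (fibValue v))
      |repₙ| = trans (sym |v|) (trans (cong length v≡) (length-pad z _))

  private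
    even-period : ∀ ℓ → 0 < ℓ → ∃ λ e → ℓ * 6 ≡ suc e * 2
    even-period (suc ℓ) _ = suc (suc (ℓ * 3)) , six ℓ
      where
      six : ∀ ℓ → suc ℓ * 6 ≡ suc (suc (suc (ℓ * 3))) * 2
      six = solve-∀

    doubled : ∀ i r ℓ k → 2 * (i + r * ℓ + k) ≡ 2 * (i + k) + r * (2 * ℓ)
    doubled = solve-∀

  rep-block^ : ∀ M → rep (fibValue (block ^ M)) ≡ block ^ M
  rep-block^ M = rep-unique (block^-zeck M)

  module _ (A : DFA) (sync : ∀ n m → Accepts A (padPair (rep n) (rep m)) ⇔ (m ≡ sumFtm rep n)) where

    probe-pumping : Pumping A block
    probe-pumping = pumping A block v K ≤-refl |v| (no11-pad⁺ pad (rep m) (proj₁ (proj₂ (zr m)))) accepted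
      where
      K = suc (DFA.size A + DFA.size A)
      N = fibValue (block ^ K)
      m = sumFtm rep N
      pad = length (rep N) ∸ length (rep m)
      v = replicate pad false ++ rep m
      m<fib : m < fib (suc (suc (length (block ^ K))))
      m<fib = ≤-<-trans (≤-trans (m≤m+n m _) (≤-trans (m≤m+n _ _) (≤-reflexive (sym (sumFtm-blocks K)))))
                        (fibValue-< (block ^ K) (block^-no11 K))
      shorter : length (rep m) ≤ length (rep N)
      shorter = subst (λ w → length (rep m) ≤ length w) (sym (rep-block^ K))
                      (rep-length-≤ (length (block ^ K)) m<fib)
      |v| : length v ≡ K * length block
      |v| = trans (length-pad pad (rep m))
                  (trans (m∸n+n≡m shorter) (trans (cong length (rep-block^ K)) (length-^ block K)))
      accepted : Accepts A (zip (block ^ K) v)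
      accepted = subst (λ w → Accepts A (zip w v)) (rep-block^ K) (sync-accepts A (sumFtm rep) sync N shorter)

    pumping-gap : Pumping A block → Σ PumpedGap λ G → 0 < PumpedGap.δ G
    pumping-gap P = gap , *-monoʳ-< 2 0<ℓ
      where
      open Pumping P
      values : ∀ r → fibValue (block ^ i ++ (block ^ ℓ) ^ r ++ block ^ k) ≡
                     2 * fibValue (x ++ y ^ r ++ z) + (2 * (i + k) + r * (2 * ℓ))
      values r = begin
        fibValue (block ^ i ++ (block ^ ℓ) ^ r ++ block ^ k)
          ≡⟨ cong fibValue (sym (^-pumped block i r ℓ k)) ⟩
        fibValue (block ^ M)
          ≡⟨ sumFtm-blocks M ⟩
        2 * sumFtm rep (fibValue (block ^ M)) + 2 * M
          ≡⟨ cong₂ (λ s t → 2 * s + t) (sym sumFtm≡) (doubled i r ℓ k) ⟩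
        2 * fibValue (x ++ y ^ r ++ z) + (2 * (i + k) + r * (2 * ℓ)) ∎
        where
        open ≡-Reasoning
        M = i + r * ℓ + k
        sumFtm≡ : fibValue (x ++ y ^ r ++ z) ≡ sumFtm rep (fibValue (block ^ M))
        sumFtm≡ = sync-accepted A (sumFtm rep) sync (fibValue (block ^ M)) (x ++ y ^ r ++ z) (no11-pumped r)
                    (trans (length-pumped r) (cong length (sym (rep-block^ M))))
                    (subst (λ w → Accepts A (zip w (x ++ y ^ r ++ z))) (sym (rep-block^ M)) (accepts-pumped r))
      gap : PumpedGap
      gap = record
        { x = x ; y = y ; z = z ; x′ = block ^ i ; y′ = block ^ ℓ ; z′ = block ^ k
        ; a = 2 ; c = 2 * (i + k) ; δ = 2 * ℓ ; e = proj₁ (even-period ℓ 0<ℓ)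
        ; length-y = trans length-y (proj₂ (even-period ℓ 0<ℓ))
        ; length-y′ = trans (length-^ block ℓ) (proj₂ (even-period ℓ 0<ℓ))
        ; values = values
        }

open Recurrence using (PumpedGap; pumped-gap-constant)
open SynchronisedSum using (probe-pumping; pumping-gap)

mainTheorem9 : (rep : ℕ → List Bool) → ZeckRep rep →
    ¬ FibSynchronised rep (sumFtm rep)
mainTheorem9 rep zr (A , sync) = <⇒≢ (proj₂ gap) (sym (pumped-gap-constant (proj₁ gap)))
  where
  gap : Σ PumpedGap λ G → 0 < PumpedGap.δ G
  gap = pumping-gap rep zr A sync (probe-pumping rep zr A sync)
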